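{- Let $p$ be an odd prime, $m$ a positive integer, $M=\mathbb F_{p^m}$, $q=p^k$ with $1\le k\le m-1$ and $m/\gcd(k,m)$ odd. For $u\in M^\times$, the map $f:M\to M$, $f(x)=xu^q+x^qu$, is invertible. -}

module Defs where

open import Level using (Level; _⊔_)
open import Data.Nat using (ℕ; _%_)
open import Data.Fin using (Fin)
open import Data.Product using (Σ; _×_; _,_)
open import Relation.Nullary using (¬_)
open import Relation.Binary.PropositionalEquality using (_≡_)
open import Algebra.Bundles using (CommutativeRing; Semiring)
import Algebra.Definitions.RawSemiring as RawSemiringDefs

record IsField {c ℓ} (R : CommutativeRing c ℓ) : Set (c ⊔ ℓ) where
  open CommutativeRing R
  field
    1≉0     : ¬ (1# ≈ 0#)
    inverse : ∀ x → ¬ (x ≈ 0#) → Σ Carrier λ y → x * y ≈ 1#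

record HasCardinality {c ℓ} (R : CommutativeRing c ℓ) (N : ℕ) : Set (c ⊔ ℓ) where
  open CommutativeRing R
  field
    enum       : Fin N → Carrier
    enum-inj   : ∀ i j → enum i ≈ enum j → i ≡ j
    enum-surj  : ∀ x → Σ (Fin N) λ i → enum i ≈ x

module Pow {c ℓ} (R : CommutativeRing c ℓ) where
  open CommutativeRing R
  open RawSemiringDefs (Semiring.rawSemiring semiring) public using (_^_)

Invertible : ∀ {c ℓ} (R : CommutativeRing c ℓ) →
             (CommutativeRing.Carrier R → CommutativeRing.Carrier R) → Set (c ⊔ ℓ)
Invertible R f = Σ (Carrier → Carrier) λ g → (∀ x → g (f x) ≈ x) × (∀ y → f (g y) ≈ y)
  where open CommutativeRing R

Odd : ℕ → Set
Odd n = n % 2 ≡ 1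

module Submission where

-- Since p = 0 in M (|M| = p^m), x ↦ x^q is additive and odd, so f is additive and it
-- suffices to show that its kernel is trivial; an injective map of a finite set is then
-- bijective. Writing w = z u, f w = u^(q+1) (z + z^q), so f w = 0 gives z^q = -z and,
-- iterating an odd number of times, z^(q^o) = -z for o = m / gcd(k,m). But q^o is a power
-- of p^m, so z^(q^o) = z by Fermat's little theorem in M. Hence z = -z, and z = 0 as p is odd.

open import Defs
open import Data.Nat.Base using (ℕ)
open import Data.Product using (_,_; proj₁; proj₂)
open import Function.Base using (_∘_)
open import Relation.Nullary using (¬_; yes; no)
open import Relation.Nullary.Negation using (contradiction)
open import Relation.Binary.PropositionalEquality as ≡ using (_≡_; _≢_)
open import Algebra.Bundles using (CommutativeSemiring; CommutativeRing; CommutativeMonoid)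

module NatProperties where

  open import Data.Nat
  open import Data.Nat.Properties
  open import Data.Nat.Divisibility
  open import Data.Nat.DivMod
  open import Data.Nat.GCD using (gcd; gcd[m,n]∣m; gcd[m,n]∣n)
  open import Data.Nat.Primality
  open import Data.Nat.Combinatorics
  open import Data.Sum using (inj₁; inj₂)
  open import Algebra.Properties.CommutativeSemigroup *-commutativeSemigroup using (xy∙z≈xz∙y)
  open ≡ using (refl; sym; trans; cong; subst)

  prime∤m! : ∀ {p} → Prime p → ∀ m → m < p → p ∤ m !
  prime∤m! {p} pp zero    _   p∣1 =
    contradiction (∣⇒≤ p∣1) (<⇒≱ (nonTrivial⇒n>1 p {{prime⇒nonTrivial pp}}))
  prime∤m! pp (suc m) m<p p∣[1+m]! with euclidsLemma (suc m) (m !) pp p∣[1+m]!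
  ... | inj₁ p∣1+m = contradiction (∣⇒≤ p∣1+m) (<⇒≱ m<p)
  ... | inj₂ p∣m!  = prime∤m! pp m (<-trans (n<1+n m) m<p) p∣m!

  n∣n! : ∀ n → .{{NonZero n}} → n ∣ n !
  n∣n! (suc n) = m∣m*n (n !)

  nCk*[k!*[n∸k]!]≡n! : ∀ {n k} → k ≤ n → (n C k) * (k ! * (n ∸ k) !) ≡ n !
  nCk*[k!*[n∸k]!]≡n! {n} {k} k≤n = trans
    (cong (_* (k ! * (n ∸ k) !)) (nCk≡n!/k![n-k]! k≤n))
    (m/n*n≡m {{k !* (n ∸ k) !≢0}} (k![n∸k]!∣n! k≤n))

  prime∣pCk : ∀ {p k} → Prime p → 0 < k → k < p → p ∣ p C k
  prime∣pCk {p} {k} pp 0<k k<p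
    with euclidsLemma (p C k) (k ! * (p ∸ k) !) pp
           (subst (p ∣_) (sym (nCk*[k!*[n∸k]!]≡n! (<⇒≤ k<p))) (n∣n! p {{prime⇒nonZero pp}}))
  ... | inj₁ p∣pCk = p∣pCk
  ... | inj₂ p∣k!*[p∸k]! with euclidsLemma (k !) ((p ∸ k) !) pp p∣k!*[p∸k]!
  ...   | inj₁ p∣k!     = contradiction p∣k! (prime∤m! pp k k<p)
  ...   | inj₂ p∣[p∸k]! = contradiction p∣[p∸k]! (prime∤m! pp (p ∸ k) (∸-monoʳ-< 0<k (<⇒≤ k<p)))

  odd-* : ∀ m n → Odd m → Odd n → Odd (m * n)
  odd-* m n m-odd n-odd =
    trans (%-distribˡ-* m n 2) (≡.cong₂ (λ a b → (a * b) % 2) m-odd n-odd)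

  odd-^ : ∀ m n → Odd m → Odd (m ^ n)
  odd-^ m zero    m-odd = refl
  odd-^ m (suc n) m-odd = odd-* m (m ^ n) m-odd (odd-^ m n m-odd)

  odd⇒≡1+[n/2]*2 : ∀ n → Odd n → n ≡ 1 + n / 2 * 2
  odd⇒≡1+[n/2]*2 n n-odd = trans (m≡m%n+[m/n]*n n 2) (cong (_+ n / 2 * 2) n-odd)

  k*[m/gcd]≡m*[k/gcd] : ∀ k m .{{_ : NonZero (gcd k m)}} →
                         k * (m / gcd k m) ≡ m * (k / gcd k m)
  k*[m/gcd]≡m*[k/gcd] k m = begin
    k * (m / d)               ≡⟨ cong (_* (m / d)) (sym (m*[n/m]≡n (gcd[m,n]∣m k m))) ⟩
    d * (k / d) * (m / d)     ≡⟨ xy∙z≈xz∙y d (k / d) (m / d) ⟩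
    d * (m / d) * (k / d)     ≡⟨ cong (_* (k / d)) (m*[n/m]≡n (gcd[m,n]∣n k m)) ⟩
    m * (k / d)               ∎
    where
    open ≡.≡-Reasoning
    d = gcd k m

  [p^k]^[m/gcd]≡[p^m]^[k/gcd] : ∀ p k m .{{_ : NonZero (gcd k m)}} →
                                 (p ^ k) ^ (m / gcd k m) ≡ (p ^ m) ^ (k / gcd k m)
  [p^k]^[m/gcd]≡[p^m]^[k/gcd] p k m = begin
    (p ^ k) ^ (m / gcd k m)   ≡⟨ ^-*-assoc p k (m / gcd k m) ⟩
    p ^ (k * (m / gcd k m))   ≡⟨ cong (p ^_) (k*[m/gcd]≡m*[k/gcd] k m) ⟩
    p ^ (m * (k / gcd k m))   ≡⟨ ^-*-assoc p m (k / gcd k m) ⟨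
    (p ^ m) ^ (k / gcd k m)   ∎
    where open ≡.≡-Reasoning

module FinProperties where

  open import Data.Nat using (suc)
  open import Data.Nat.Properties using (<-irrefl)
  open import Data.Fin using (Fin; punchOut; _≟_)
  open import Data.Fin.Properties using (any?; punchOut-injective; injective⇒≤)
  open import Function.Definitions using (Injective; StrictlySurjective)

  injective⇒strictlySurjective : ∀ {n} {f : Fin n → Fin n} →
                                 Injective _≡_ _≡_ f → StrictlySurjective _≡_ f
  injective⇒strictlySurjective {suc n} {f} f-inj j with any? (λ i → f i ≟ j)
  ... | yes j∈image = j∈image
  ... | no  j∉image = contradiction (injective⇒≤ g-inj) (<-irrefl ≡.refl)
    where
    g : Fin (suc n) → Fin n
    g i = punchOut {i = j} {j = f i} (λ j≡fi → j∉image (i , ≡.sym j≡fi))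
    g-inj : Injective _≡_ _≡_ g
    g-inj {a} {b} = f-inj ∘ punchOut-injective
      (λ j≡fa → j∉image (a , ≡.sym j≡fa)) (λ j≡fb → j∉image (b , ≡.sym j≡fb))

module CommutativeSemiringProperties {c ℓ} (R : CommutativeSemiring c ℓ) where

  open import Data.Nat as ℕ using (zero; suc; _<_; z<s; s<s)
  open import Data.Nat.Divisibility using (divides)
  open import Data.Nat.Primality using (Prime)
  open import Data.Nat.Combinatorics using (_C_; nCn≡1)
  open import Data.Nat.Properties using (n∸n≡0)
  open import Data.Fin as Fin using (Fin; toℕ; inject₁; fromℕ)
  open import Data.Fin.Properties using (toℕ<n; toℕ-inject₁; toℕ-fromℕ)
  open NatProperties using (prime∣pCk)

  open CommutativeSemiring R
  open import Algebra.Properties.Semiring.Mult semiring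
  open import Algebra.Properties.CommutativeSemiring.Exp R
  open import Algebra.Properties.CommutativeSemiring.Binomial R using (theorem; binomialTerm)
  open import Algebra.Properties.CommutativeMonoid.Sum +-commutativeMonoid
    using (sum; sum-init-last; sum-cong-≋; sum-replicate-zero)
  open import Relation.Binary.Reasoning.Setoid setoid

  ×-zeroʳ : ∀ n → n × 0# ≈ 0#
  ×-zeroʳ n = begin
    n × 0#          ≈⟨ ×-congʳ n (zeroˡ 0#) ⟨
    n × (0# * 0#)   ≈⟨ ×-assoc-* n 0# 0# ⟨
    (n × 0#) * 0#   ≈⟨ zeroʳ _ ⟩
    0#              ∎

  n×1≈0⇒n×x≈0 : ∀ {n} → n × 1# ≈ 0# → ∀ x → n × x ≈ 0#
  n×1≈0⇒n×x≈0 {n} n×1≈0 x = begin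
    n × x          ≈⟨ ×-congʳ n (*-identityˡ x) ⟨
    n × (1# * x)   ≈⟨ ×-assoc-* n 1# x ⟨
    (n × 1#) * x   ≈⟨ *-congʳ n×1≈0 ⟩
    0# * x         ≈⟨ zeroˡ x ⟩
    0#             ∎

  ×1-homo-^ : ∀ m n → (m ℕ.^ n) × 1# ≈ (m × 1#) ^ n
  ×1-homo-^ m zero    = +-identityʳ 1#
  ×1-homo-^ m (suc n) = trans (×1-homo-* m (m ℕ.^ n)) (*-congˡ (×1-homo-^ m n))

  x^n≈x⇒x^[n^r]≈x : ∀ {x n} → x ^ n ≈ x → ∀ r → x ^ (n ℕ.^ r) ≈ x
  x^n≈x⇒x^[n^r]≈x {x} {n} x^n≈x zero    = *-identityʳ x
  x^n≈x⇒x^[n^r]≈x {x} {n} x^n≈x (suc r) = begin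
    x ^ (n ℕ.* n ℕ.^ r)   ≈⟨ ^-assocʳ x n (n ℕ.^ r) ⟨
    (x ^ n) ^ (n ℕ.^ r)   ≈⟨ ^-congˡ (n ℕ.^ r) x^n≈x ⟩
    x ^ (n ℕ.^ r)         ≈⟨ x^n≈x⇒x^[n^r]≈x x^n≈x r ⟩
    x                     ∎

  freshmansDream : ∀ n → (∀ i → 0 < i → i < suc n → (suc n C i) × 1# ≈ 0#) →
                   ∀ x y → (x + y) ^ suc n ≈ x ^ suc n + y ^ suc n
  freshmansDream n middle≈0 x y = begin
    (x + y) ^ p                                 ≈⟨ theorem p x y ⟩
    t Fin.zero + sum (λ i → t (Fin.suc i))      ≈⟨ +-congˡ (sum-init-last (λ i → t (Fin.suc i))) ⟩
    t Fin.zero + (sum (λ j → t (Fin.suc (inject₁ j))) + t (Fin.suc (fromℕ n)))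
      ≈⟨ +-cong first (+-cong (trans (sum-cong-≋ middle) (sum-replicate-zero n)) last) ⟩
    y ^ p + (0# + x ^ p)                        ≈⟨ +-congˡ (+-identityˡ _) ⟩
    y ^ p + x ^ p                               ≈⟨ +-comm _ _ ⟩
    x ^ p + y ^ p                               ∎
    where
    p = suc n
    t : Fin (suc p) → Carrier
    t = binomialTerm x y p
    first : t Fin.zero ≈ y ^ p
    first = trans (+-identityʳ _) (*-identityˡ _)
    middle : ∀ j → t (Fin.suc (inject₁ j)) ≈ 0#
    middle j = n×1≈0⇒n×x≈0 {p C i} (middle≈0 i z<s (s<s i<n)) _
      where
      i = suc (toℕ (inject₁ j))
      i<n : toℕ (inject₁ j) < n
      i<n = ≡.subst (_< n) (≡.sym (toℕ-inject₁ j)) (toℕ<n j)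
    last : t (Fin.suc (fromℕ n)) ≈ x ^ p
    last = begin
      t (Fin.suc (fromℕ n))
        ≡⟨ ≡.cong (λ k → (p C k) × (x ^ k * y ^ (p ℕ.∸ k))) (≡.cong suc (toℕ-fromℕ n)) ⟩
      (p C p) × (x ^ p * y ^ (p ℕ.∸ p))
        ≡⟨ ≡.cong₂ (λ a b → a × (x ^ p * y ^ b)) (nCn≡1 p) (n∸n≡0 p) ⟩
      1 × (x ^ p * 1#)     ≈⟨ +-identityʳ _ ⟩
      x ^ p * 1#           ≈⟨ *-identityʳ _ ⟩
      x ^ p                ∎

  frobenius : ∀ {p} → Prime p → p × 1# ≈ 0# → ∀ x y → (x + y) ^ p ≈ x ^ p + y ^ p
  frobenius {suc n} p-prime p×1≈0 = freshmansDream n pCi×1≈0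
    where
    p = suc n
    pCi×1≈0 : ∀ i → 0 < i → i < p → (p C i) × 1# ≈ 0#
    pCi×1≈0 i 0<i i<p with prime∣pCk p-prime 0<i i<p
    ... | divides c pCi≡c*p = begin
      (p C i) × 1#          ≡⟨ ≡.cong (_× 1#) pCi≡c*p ⟩
      (c ℕ.* p) × 1#        ≈⟨ ×1-homo-* c p ⟩
      (c × 1#) * (p × 1#)   ≈⟨ *-congˡ p×1≈0 ⟩
      (c × 1#) * 0#         ≈⟨ zeroʳ _ ⟩
      0#                    ∎

  frobenius-^ : ∀ {p} → Prime p → p × 1# ≈ 0# →
                ∀ k x y → (x + y) ^ (p ℕ.^ k) ≈ x ^ (p ℕ.^ k) + y ^ (p ℕ.^ k)
  frobenius-^ p-prime p×1≈0 zero    x y =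
    trans (*-identityʳ _) (sym (+-cong (*-identityʳ x) (*-identityʳ y)))
  frobenius-^ {p} p-prime p×1≈0 (suc k) x y = begin
    (x + y) ^ (p ℕ.* p ℕ.^ k)                  ≈⟨ ^-assocʳ (x + y) p (p ℕ.^ k) ⟨
    ((x + y) ^ p) ^ (p ℕ.^ k)                  ≈⟨ ^-congˡ (p ℕ.^ k) (frobenius p-prime p×1≈0 x y) ⟩
    (x ^ p + y ^ p) ^ (p ℕ.^ k)                ≈⟨ frobenius-^ p-prime p×1≈0 k (x ^ p) (y ^ p) ⟩
    (x ^ p) ^ (p ℕ.^ k) + (y ^ p) ^ (p ℕ.^ k)
      ≈⟨ +-cong (^-assocʳ x p (p ℕ.^ k)) (^-assocʳ y p (p ℕ.^ k)) ⟩
    x ^ (p ℕ.* p ℕ.^ k) + y ^ (p ℕ.* p ℕ.^ k)  ∎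

module CommutativeRingProperties {c ℓ} (R : CommutativeRing c ℓ) where

  open import Data.Nat as ℕ using (zero; suc)
  open import Data.Nat.DivMod using (_/_)
  open import Data.Nat.Primality using (Prime)
  open NatProperties using (odd-^; odd⇒≡1+[n/2]*2)

  open CommutativeRing R
  open CommutativeSemiringProperties commutativeSemiring public
  open import Algebra.Properties.Semiring.Mult semiring using (_×_; ×-assocˡ; ×-congʳ)
  open import Algebra.Properties.CommutativeSemiring.Exp commutativeSemiring
    using (_^_; ^-congˡ; ^-assocʳ; ^-distrib-*)
  open import Algebra.Properties.Ring ring using (-‿distribˡ-*; -‿distribʳ-*)
  open import Algebra.Properties.AbelianGroup +-abelianGroup
    using (⁻¹-involutive; ⁻¹-∙-comm; x∙y⁻¹≈ε⇒x≈y)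
  open import Algebra.Solver.Ring.NaturalCoefficients.Default commutativeSemiring
  open import Relation.Binary.Reasoning.Setoid setoid

  -x*-y≈x*y : ∀ x y → - x * - y ≈ x * y
  -x*-y≈x*y x y = begin
    - x * - y       ≈⟨ -‿distribˡ-* x (- y) ⟨
    - (x * - y)     ≈⟨ -‿cong (-‿distribʳ-* x y) ⟨
    - (- (x * y))   ≈⟨ ⁻¹-involutive (x * y) ⟩
    x * y           ∎

  [-x]^[1+r*2]≈-x^[1+r*2] : ∀ x r → (- x) ^ (1 ℕ.+ r ℕ.* 2) ≈ - (x ^ (1 ℕ.+ r ℕ.* 2))
  [-x]^[1+r*2]≈-x^[1+r*2] x zero    = sym (-‿distribˡ-* x 1#)
  [-x]^[1+r*2]≈-x^[1+r*2] x (suc r) = begin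
    - x * (- x * (- x) ^ n)       ≈⟨ *-congˡ (*-congˡ ([-x]^[1+r*2]≈-x^[1+r*2] x r)) ⟩
    - x * (- x * - (x ^ n))       ≈⟨ *-congˡ (-x*-y≈x*y x (x ^ n)) ⟩
    - x * (x * x ^ n)             ≈⟨ -‿distribˡ-* x _ ⟨
    - (x * (x * x ^ n))           ∎
    where n = 1 ℕ.+ r ℕ.* 2

  [-x]^odd≈-x^odd : ∀ n → Odd n → ∀ x → (- x) ^ n ≈ - (x ^ n)
  [-x]^odd≈-x^odd n n-odd x = ≡.subst (λ m → (- x) ^ m ≈ - (x ^ m))
    (≡.sym (odd⇒≡1+[n/2]*2 n n-odd)) ([-x]^[1+r*2]≈-x^[1+r*2] x (n / 2))

  [x-y]^p^k≈x^p^k-y^p^k : ∀ {p} → Prime p → Odd p → p × 1# ≈ 0# →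
                          ∀ k x y → (x - y) ^ (p ℕ.^ k) ≈ x ^ (p ℕ.^ k) - y ^ (p ℕ.^ k)
  [x-y]^p^k≈x^p^k-y^p^k {p} p-prime p-odd p×1≈0 k x y =
    trans (frobenius-^ p-prime p×1≈0 k x (- y))
          (+-congˡ ([-x]^odd≈-x^odd (p ℕ.^ k) (odd-^ p k p-odd) y))

  1+1≈0⇒1≈0 : ∀ p → Odd p → p × 1# ≈ 0# → 1# + 1# ≈ 0# → 1# ≈ 0#
  1+1≈0⇒1≈0 p p-odd p×1≈0 1+1≈0 = begin
    1#                       ≈⟨ +-identityʳ 1# ⟨
    1# + 0#                  ≈⟨ +-congˡ [p/2*2]×1≈0 ⟨
    (1 ℕ.+ r ℕ.* 2) × 1#     ≡⟨ ≡.cong (_× 1#) (odd⇒≡1+[n/2]*2 p p-odd) ⟨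
    p × 1#                   ≈⟨ p×1≈0 ⟩
    0#                       ∎
    where
    r = p / 2
    [p/2*2]×1≈0 : (r ℕ.* 2) × 1# ≈ 0#
    [p/2*2]×1≈0 = begin
      (r ℕ.* 2) × 1#   ≈⟨ ×-assocˡ 1# r 2 ⟨
      r × (2 × 1#)     ≈⟨ ×-congʳ r (trans (+-congˡ (+-identityʳ 1#)) 1+1≈0) ⟩
      r × 0#           ≈⟨ ×-zeroʳ r ⟩
      0#               ∎

  module _ {q} (q-odd : Odd q) {z} (z^q≈-z : z ^ q ≈ - z) where

    z^q^[1+j]≈-z^q^j : ∀ j → z ^ (q ℕ.^ suc j) ≈ - (z ^ (q ℕ.^ j))
    z^q^[1+j]≈-z^q^j j = begin
      z ^ (q ℕ.* q ℕ.^ j)   ≈⟨ ^-assocʳ z q (q ℕ.^ j) ⟨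
      (z ^ q) ^ (q ℕ.^ j)   ≈⟨ ^-congˡ (q ℕ.^ j) z^q≈-z ⟩
      (- z) ^ (q ℕ.^ j)     ≈⟨ [-x]^odd≈-x^odd (q ℕ.^ j) (odd-^ q j q-odd) z ⟩
      - (z ^ (q ℕ.^ j))     ∎

    z^q^[1+r*2]≈-z : ∀ r → z ^ (q ℕ.^ (1 ℕ.+ r ℕ.* 2)) ≈ - z
    z^q^[1+r*2]≈-z zero    = trans (z^q^[1+j]≈-z^q^j 0) (-‿cong (*-identityʳ z))
    z^q^[1+r*2]≈-z (suc r) = begin
      z ^ (q ℕ.^ (3 ℕ.+ r ℕ.* 2))         ≈⟨ z^q^[1+j]≈-z^q^j (2 ℕ.+ r ℕ.* 2) ⟩
      - (z ^ (q ℕ.^ (2 ℕ.+ r ℕ.* 2)))     ≈⟨ -‿cong (z^q^[1+j]≈-z^q^j (1 ℕ.+ r ℕ.* 2)) ⟩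
      - - (z ^ (q ℕ.^ (1 ℕ.+ r ℕ.* 2)))   ≈⟨ ⁻¹-involutive _ ⟩
      z ^ (q ℕ.^ (1 ℕ.+ r ℕ.* 2))         ≈⟨ z^q^[1+r*2]≈-z r ⟩
      - z                                 ∎

    z^q^odd≈-z : ∀ o → Odd o → z ^ (q ℕ.^ o) ≈ - z
    z^q^odd≈-z o o-odd = ≡.subst (λ n → z ^ (q ℕ.^ n) ≈ - z)
      (≡.sym (odd⇒≡1+[n/2]*2 o o-odd)) (z^q^[1+r*2]≈-z (o / 2))

  twisted-scale : ∀ q u z → (z * u) * u ^ q + (z * u) ^ q * u ≈ u ^ suc q * (z + z ^ q)
  twisted-scale q u z = begin
    (z * u) * u ^ q + (z * u) ^ q * u           ≈⟨ +-congˡ (*-congʳ (^-distrib-* z u q)) ⟩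
    (z * u) * u ^ q + (z ^ q * u ^ q) * u       ≈⟨ solve 4 (λ z u U Z → ((z :* u) :* U) :+ ((Z :* U) :* u)
                                                                   := (u :* U) :* (z :+ Z))
                                                      refl z u (u ^ q) (z ^ q) ⟩
    u ^ suc q * (z + z ^ q)                     ∎

  twisted-sub : ∀ q → (∀ x y → (x - y) ^ q ≈ x ^ q - y ^ q) → ∀ a b x y →
                (x - y) * a + (x - y) ^ q * b ≈ (x * a + x ^ q * b) - (y * a + y ^ q * b)
  twisted-sub q [x-y]^q≈x^q-y^q a b x y = begin
    (x - y) * a + (x - y) ^ q * b               ≈⟨ +-congˡ (*-congʳ ([x-y]^q≈x^q-y^q x y)) ⟩
    (x - y) * a + (x ^ q - y ^ q) * b
      ≈⟨ solve 6 (λ x y′ a X Y′ b → ((x :+ y′) :* a) :+ ((X :+ Y′) :* b)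
                                 := ((x :* a) :+ (X :* b)) :+ ((y′ :* a) :+ (Y′ :* b)))
                 refl x (- y) a (x ^ q) (- (y ^ q)) b ⟩
    (x * a + x ^ q * b) + (- y * a + - (y ^ q) * b)
      ≈⟨ +-congˡ (+-cong (-‿distribˡ-* y a) (-‿distribˡ-* (y ^ q) b)) ⟨
    (x * a + x ^ q * b) + (- (y * a) + - (y ^ q * b))
      ≈⟨ +-congˡ (⁻¹-∙-comm (y * a) (y ^ q * b)) ⟩
    (x * a + x ^ q * b) - (y * a + y ^ q * b)   ∎

  kernel≈0⇒injective : ∀ (f : Carrier → Carrier) → (∀ x y → f (x - y) ≈ f x - f y) →
                       (∀ x → f x ≈ 0# → x ≈ 0#) → ∀ {x y} → f x ≈ f y → x ≈ y
  kernel≈0⇒injective f f-sub kernel≈0 {x} {y} fx≈fy = x∙y⁻¹≈ε⇒x≈y x y (kernel≈0 (x - y) (begin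
    f (x - y)      ≈⟨ f-sub x y ⟩
    f x - f y      ≈⟨ +-congˡ (-‿cong fx≈fy) ⟨
    f x - f x      ≈⟨ -‿inverseʳ (f x) ⟩
    0#             ∎))

module FieldProperties {c ℓ} {M : CommutativeRing c ℓ} (F : IsField M) where

  open import Data.Nat using (zero; suc)
  open import Data.Fin as Fin using (Fin)
  open import Relation.Binary.Definitions using (Decidable)

  open CommutativeRing M
  open IsField F
  open CommutativeRingProperties M using (twisted-scale)
  open import Algebra.Properties.CommutativeSemiring.Exp commutativeSemiring using (_^_; ^-congˡ)
  open import Algebra.Properties.CommutativeMonoid.Sum *-commutativeMonoid using () renaming (sum to product)
  open import Algebra.Properties.Monoid *-monoid using (cancelˡ; cancelʳ)
  open import Relation.Binary.Reasoning.Setoid setoid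

  *-cancelˡ-≉0 : ∀ {x y z} → ¬ x ≈ 0# → x * y ≈ x * z → y ≈ z
  *-cancelˡ-≉0 {x} {y} {z} x≉0 xy≈xz = begin
    y               ≈⟨ cancelˡ x′x≈1 y ⟨
    x′ * (x * y)    ≈⟨ *-congˡ xy≈xz ⟩
    x′ * (x * z)    ≈⟨ cancelˡ x′x≈1 z ⟩
    z               ∎
    where
    x′ = proj₁ (inverse x x≉0)
    x′x≈1 : x′ * x ≈ 1#
    x′x≈1 = trans (*-comm x′ x) (proj₂ (inverse x x≉0))

  x*y≈0⇒y≈0 : ∀ {x y} → ¬ x ≈ 0# → x * y ≈ 0# → y ≈ 0#
  x*y≈0⇒y≈0 {x} x≉0 xy≈0 = *-cancelˡ-≉0 x≉0 (trans xy≈0 (sym (zeroʳ x)))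

  x≉0∧y≉0⇒x*y≉0 : ∀ {x y} → ¬ x ≈ 0# → ¬ y ≈ 0# → ¬ x * y ≈ 0#
  x≉0∧y≉0⇒x*y≉0 x≉0 y≉0 xy≈0 = y≉0 (x*y≈0⇒y≈0 x≉0 xy≈0)

  x≉0⇒x^n≉0 : ∀ {x} → ¬ x ≈ 0# → ∀ n → ¬ x ^ n ≈ 0#
  x≉0⇒x^n≉0 x≉0 zero    = 1≉0
  x≉0⇒x^n≉0 x≉0 (suc n) = x≉0∧y≉0⇒x*y≉0 x≉0 (x≉0⇒x^n≉0 x≉0 n)

  product≉0 : ∀ {n} (t : Fin n → Carrier) → (∀ i → ¬ t i ≈ 0#) → ¬ product t ≈ 0#
  product≉0 {zero}  t t≉0 = 1≉0
  product≉0 {suc n} t t≉0 =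
    x≉0∧y≉0⇒x*y≉0 (t≉0 Fin.zero) (product≉0 (λ i → t (Fin.suc i)) (λ i → t≉0 (Fin.suc i)))

  x^n≈0⇒x≈0 : Decidable _≈_ → ∀ {x} n → x ^ n ≈ 0# → x ≈ 0#
  x^n≈0⇒x≈0 _≟_ {x} n x^n≈0 with x ≟ 0#
  ... | yes x≈0 = x≈0
  ... | no  x≉0 = contradiction x^n≈0 (x≉0⇒x^n≉0 x≉0 n)

  x≈-x⇒x≈0 : ¬ 1# + 1# ≈ 0# → ∀ {x} → x ≈ - x → x ≈ 0#
  x≈-x⇒x≈0 2≉0 {x} x≈-x = x*y≈0⇒y≈0 2≉0 (begin
    (1# + 1#) * x     ≈⟨ distribʳ x 1# 1# ⟩
    1# * x + 1# * x   ≈⟨ +-cong (*-identityˡ x) (trans (*-identityˡ x) x≈-x) ⟩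
    x - x             ≈⟨ -‿inverseʳ x ⟩
    0#                ∎)

  twisted-kernel : ∀ {q u} → ¬ u ≈ 0# → (∀ z → z + z ^ q ≈ 0# → z ≈ 0#) →
                   ∀ w → w * u ^ q + w ^ q * u ≈ 0# → w ≈ 0#
  twisted-kernel {q} {u} u≉0 roots≈0 w fw≈0 = begin
    w        ≈⟨ w≈z*u ⟩
    z * u    ≈⟨ *-congʳ z≈0 ⟩
    0# * u   ≈⟨ zeroˡ u ⟩
    0#       ∎
    where
    u′ = proj₁ (inverse u u≉0)
    z = w * u′
    w≈z*u : w ≈ z * u
    w≈z*u = sym (cancelʳ (trans (*-comm u′ u) (proj₂ (inverse u u≉0))) w)
    z≈0 : z ≈ 0#
    z≈0 = roots≈0 z (x*y≈0⇒y≈0 (x≉0⇒x^n≉0 u≉0 (suc q)) (begin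
      u ^ suc q * (z + z ^ q)             ≈⟨ twisted-scale q u z ⟨
      (z * u) * u ^ q + (z * u) ^ q * u   ≈⟨ +-cong (*-congʳ w≈z*u) (*-congʳ (^-congˡ q w≈z*u)) ⟨
      w * u ^ q + w ^ q * u               ≈⟨ fw≈0 ⟩
      0#                                  ∎))

module FiniteRingProperties {c ℓ} {M : CommutativeRing c ℓ} {N : ℕ} (H : HasCardinality M N) where

  open import Data.Fin as Fin using (Fin)
  open import Data.Fin.Permutation using (Permutation′; permutation)
  open import Function.Definitions using (StrictlySurjective; StrictlyInverseˡ; StrictlyInverseʳ)
  open import Relation.Binary.Core using (_Preserves_⟶_)
  open import Relation.Binary.Definitions using (Decidable)
  open FinProperties using (injective⇒strictlySurjective)

  open CommutativeRing M
  open HasCardinality H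
  open import Algebra.Definitions _≈_ using (Congruent₁)
  open import Algebra.Properties.Semiring.Mult semiring using (_×_)
  open import Algebra.Properties.AbelianGroup +-abelianGroup using (identityˡ-unique)
  open import Algebra.Properties.Monoid +-monoid using (cancelˡ)
  open import Algebra.Properties.CommutativeMonoid.Sum +-commutativeMonoid
    using (∑-distrib-+; sum-replicate) renaming (sum to ∑)
  open import Relation.Binary.Reasoning.Setoid setoid

  index : Carrier → Fin N
  index x = proj₁ (enum-surj x)

  enum∘index : ∀ x → enum (index x) ≈ x
  enum∘index x = proj₂ (enum-surj x)

  index-injective : ∀ {x y} → index x ≡ index y → x ≈ y
  index-injective {x} {y} ix≡iy =
    trans (sym (enum∘index x)) (trans (reflexive (≡.cong enum ix≡iy)) (enum∘index y))

  ≈-dec : Decidable _≈_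
  ≈-dec x y with index x Fin.≟ index y
  ... | yes ix≡iy = yes (index-injective ix≡iy)
  ... | no  ix≢iy = no λ x≈y →
    ix≢iy (enum-inj _ _ (trans (enum∘index x) (trans x≈y (sym (enum∘index y)))))

  injective⇒invertible : ∀ f → (∀ {x y} → f x ≈ f y → x ≈ y) → Invertible M f
  injective⇒invertible f f-inj = g , (λ x → f-inj (f∘g (f x))) , f∘g
    where
    f̂ : Fin N → Fin N
    f̂ i = index (f (enum i))
    f̂-surj : StrictlySurjective _≡_ f̂
    f̂-surj = injective⇒strictlySurjective {f = f̂} λ {i} {j} f̂i≡f̂j →
      enum-inj i j (f-inj (index-injective f̂i≡f̂j))
    g : Carrier → Carrier
    g y = enum (proj₁ (f̂-surj (index y)))
    f∘g : ∀ y → f (g y) ≈ y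
    f∘g y = trans (sym (enum∘index _))
                  (trans (reflexive (≡.cong enum (proj₂ (f̂-surj (index y))))) (enum∘index y))

  module _ {c′ ℓ′} (C : CommutativeMonoid c′ ℓ′) where

    open CommutativeMonoid C using () renaming (Carrier to A; _≈_ to _≈ᶜ_; trans to transᶜ)
    open import Algebra.Properties.CommutativeMonoid.Sum C using (sum; sum-permute; sum-cong-≋)

    sum-reindex : ∀ {h : Carrier → A} → h Preserves _≈_ ⟶ _≈ᶜ_ →
                  ∀ {φ ψ} → Congruent₁ φ → Congruent₁ ψ →
                  StrictlyInverseˡ _≈_ φ ψ → StrictlyInverseʳ _≈_ φ ψ →
                  sum (h ∘ enum) ≈ᶜ sum (h ∘ φ ∘ enum)
    sum-reindex {h} h-cong {φ} {ψ} φ-cong ψ-cong φ∘ψ ψ∘φ =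
      transᶜ (sum-permute (h ∘ enum) π) (sum-cong-≋ (λ i → h-cong (enum∘index (φ (enum i)))))
      where
      π : Permutation′ N
      π = permutation (λ i → index (φ (enum i))) (λ j → index (ψ (enum j)))
        (λ j → enum-inj _ _ (trans (enum∘index _) (trans (φ-cong (enum∘index _)) (φ∘ψ (enum j)))))
        (λ i → enum-inj _ _ (trans (enum∘index _) (trans (ψ-cong (enum∘index _)) (ψ∘φ (enum i)))))

  N×1≈0 : N × 1# ≈ 0#
  N×1≈0 = identityˡ-unique (N × 1#) (∑ enum) (sym (begin
    ∑ enum                      ≈⟨ sum-reindex +-commutativeMonoid (λ x≈y → x≈y) +-congˡ +-congˡ
                                      (cancelˡ (-‿inverseʳ 1#)) (cancelˡ (-‿inverseˡ 1#)) ⟩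
    ∑ (λ i → 1# + enum i)       ≈⟨ ∑-distrib-+ {N} (λ _ → 1#) enum ⟩
    ∑ {N} (λ _ → 1#) + ∑ enum   ≈⟨ +-congʳ (sum-replicate N) ⟩
    N × 1# + ∑ enum             ∎))

module FiniteFieldProperties {c ℓ} {M : CommutativeRing c ℓ} (F : IsField M) where

  open import Data.Nat as ℕ using (zero; suc)
  open import Data.Fin as Fin using (Fin)
  open import Data.Fin.Properties using (¬Fin0; punchInᵢ≢i)
  open import Data.Vec.Functional using (removeAt)

  open CommutativeRing M
  open IsField F
  open FieldProperties F
  open CommutativeRingProperties M using (×1-homo-^; x^n≈x⇒x^[n^r]≈x; z^q^odd≈-z)
  open import Algebra.Properties.Semiring.Mult semiring using (_×_)
  open import Algebra.Properties.CommutativeSemiring.Exp commutativeSemiring using (_^_)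
  open import Algebra.Properties.AbelianGroup +-abelianGroup using (inverseʳ-unique)
  open import Algebra.Properties.CommutativeMonoid.Sum *-commutativeMonoid
    using (sum-remove; sum-cong-≋; sum-replicate; ∑-distrib-+) renaming (sum to product)
  open import Algebra.Properties.Monoid *-monoid using (cancelˡ)
  open import Relation.Binary.Reasoning.Setoid setoid

  module _ {n} (H : HasCardinality M (suc n)) where

    open HasCardinality H
    open FiniteRingProperties H

    -- The product of ifNonzero y y over all y is the product of the units of M; it is
    -- invariant under y ↦ x y, which multiplies it by x^n (the classical proof of Fermat).
    ifNonzero : Carrier → Carrier → Carrier
    ifNonzero y a with ≈-dec y 0#
    ... | yes _ = 1#
    ... | no  _ = a

    ifNonzero-cong : ∀ {y y′ a a′} → y ≈ y′ → a ≈ a′ → ifNonzero y a ≈ ifNonzero y′ a′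
    ifNonzero-cong {y} {y′} y≈y′ a≈a′ with ≈-dec y 0# | ≈-dec y′ 0#
    ... | yes _    | yes _     = refl
    ... | no  _    | no  _     = a≈a′
    ... | yes y≈0  | no  y′≉0  = contradiction (trans (sym y≈y′) y≈0) y′≉0
    ... | no  y≉0  | yes y′≈0  = contradiction (trans y≈y′ y′≈0) y≉0

    ifNonzero-self≉0 : ∀ y → ¬ ifNonzero y y ≈ 0#
    ifNonzero-self≉0 y with ≈-dec y 0#
    ... | yes _   = 1≉0
    ... | no  y≉0 = y≉0

    ifNonzero-* : ∀ {x} → ¬ x ≈ 0# → ∀ y → ifNonzero (x * y) (x * y) ≈ ifNonzero y x * ifNonzero y y
    ifNonzero-* {x} x≉0 y with ≈-dec y 0# | ≈-dec (x * y) 0#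
    ... | yes _    | yes _     = sym (*-identityʳ 1#)
    ... | no  _    | no  _     = refl
    ... | yes y≈0  | no  xy≉0  = contradiction (trans (*-congˡ y≈0) (zeroʳ x)) xy≉0
    ... | no  y≉0  | yes xy≈0  = contradiction (x*y≈0⇒y≈0 x≉0 xy≈0) y≉0

    product-ifNonzero : ∀ x → product (λ i → ifNonzero (enum i) x) ≈ x ^ n
    product-ifNonzero x = begin
      product t                           ≈⟨ sum-remove {i = index 0#} t ⟩
      t (index 0#) * product (removeAt t (index 0#))
        ≈⟨ *-cong t[index0]≈1 (sum-cong-≋ {n} (λ j → t≈x (punchInᵢ≢i (index 0#) j))) ⟩
      1# * product {n} (λ _ → x)          ≈⟨ *-identityˡ _ ⟩
      product {n} (λ _ → x)               ≈⟨ sum-replicate n ⟩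
      x ^ n                               ∎
      where
      t : Fin (suc n) → Carrier
      t i = ifNonzero (enum i) x
      t[index0]≈1 : t (index 0#) ≈ 1#
      t[index0]≈1 with ≈-dec (enum (index 0#)) 0#
      ... | yes _    = refl
      ... | no  e≉0  = contradiction (enum∘index 0#) e≉0
      t≈x : ∀ {i} → i ≢ index 0# → t i ≈ x
      t≈x {i} i≢i₀ with ≈-dec (enum i) 0#
      ... | yes e≈0  = contradiction (enum-inj _ _ (trans e≈0 (sym (enum∘index 0#)))) i≢i₀
      ... | no  _    = refl

    x≉0⇒x^n≈1 : ∀ {x} → ¬ x ≈ 0# → x ^ n ≈ 1#
    x≉0⇒x^n≈1 {x} x≉0 = *-cancelˡ-≉0 P≉0 (begin
      P * x ^ n       ≈⟨ *-comm P (x ^ n) ⟩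
      x ^ n * P       ≈⟨ *-congʳ (product-ifNonzero x) ⟨
      product (λ i → ifNonzero (enum i) x) * P
                      ≈⟨ ∑-distrib-+ {suc n} (λ i → ifNonzero (enum i) x) (λ i → G (enum i)) ⟨
      product (λ i → ifNonzero (enum i) x * G (enum i))
                      ≈⟨ sum-cong-≋ {suc n} (λ i → ifNonzero-* x≉0 (enum i)) ⟨
      product (λ i → G (x * enum i))
                      ≈⟨ sum-reindex *-commutativeMonoid (λ y≈y′ → ifNonzero-cong y≈y′ y≈y′)
                           *-congˡ *-congˡ (cancelˡ x*x′≈1) (cancelˡ x′*x≈1) ⟨
      P               ≈⟨ *-identityʳ P ⟨
      P * 1#          ∎)
      where
      G : Carrier → Carrier
      G y = ifNonzero y y
      P = product (λ i → G (enum i))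
      P≉0 : ¬ P ≈ 0#
      P≉0 = product≉0 (λ i → G (enum i)) (λ i → ifNonzero-self≉0 (enum i))
      x′ = proj₁ (inverse x x≉0)
      x*x′≈1 : x * x′ ≈ 1#
      x*x′≈1 = proj₂ (inverse x x≉0)
      x′*x≈1 : x′ * x ≈ 1#
      x′*x≈1 = trans (*-comm x′ x) x*x′≈1

  x^N≈x : ∀ {N} → HasCardinality M N → ∀ x → x ^ N ≈ x
  x^N≈x {zero}  H x = contradiction (proj₁ (HasCardinality.enum-surj H x)) ¬Fin0
  x^N≈x {suc n} H x with FiniteRingProperties.≈-dec H x 0#
  ... | yes x≈0 = trans (*-congʳ x≈0) (trans (zeroˡ _) (sym x≈0))
  ... | no  x≉0 = trans (*-congˡ (x≉0⇒x^n≈1 H x≉0)) (*-identityʳ x)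

  cardinality-p^m⇒p×1≈0 : ∀ p m → HasCardinality M (p ℕ.^ m) → p × 1# ≈ 0#
  cardinality-p^m⇒p×1≈0 p m H =
    x^n≈0⇒x≈0 (FiniteRingProperties.≈-dec H) m (trans (sym (×1-homo-^ p m)) (FiniteRingProperties.N×1≈0 H))

  z+z^q≈0⇒z≈0 : ∀ {N} → HasCardinality M N → ¬ 1# + 1# ≈ 0# →
                ∀ q o t → Odd q → Odd o → q ℕ.^ o ≡ N ℕ.^ t →
                ∀ z → z + z ^ q ≈ 0# → z ≈ 0#
  z+z^q≈0⇒z≈0 {N} H 2≉0 q o t q-odd o-odd q^o≡N^t z z+z^q≈0 = x≈-x⇒x≈0 2≉0 (begin
    z                ≈⟨ x^n≈x⇒x^[n^r]≈x (x^N≈x H z) t ⟨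
    z ^ (N ℕ.^ t)    ≡⟨ ≡.cong (z ^_) q^o≡N^t ⟨
    z ^ (q ℕ.^ o)    ≈⟨ z^q^odd≈-z q-odd (inverseʳ-unique z (z ^ q) z+z^q≈0) o o-odd ⟩
    - z              ∎)

open import Data.Nat using (_≤_; _∸_; _^_; _/_; NonZero)
open import Data.Nat.GCD using (gcd)
open import Data.Nat.Primality using (Prime)
import Algebra.Properties.Semiring.Mult as SemiringMult

lemma4p1 : ∀ {c ℓ} (p m k : ℕ) → Prime p → Odd p → 1 ≤ m →
           1 ≤ k → k ≤ m ∸ 1 →
           .{{_ : NonZero (gcd k m)}} → Odd (m / gcd k m) →
           (M : CommutativeRing c ℓ) → IsField M → HasCardinality M (p ^ m) →
           let open CommutativeRing M
               open Pow M renaming (_^_ to _^ᴹ_)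
               q = p ^ k
           in (u : Carrier) → ¬ (u ≈ 0#) →
              Invertible M (λ x → (x * (u ^ᴹ q)) + ((x ^ᴹ q) * u))
lemma4p1 p m k p-prime p-odd _ _ _ o-odd M F H u u≉0 =
  injective⇒invertible f (kernel≈0⇒injective f f-sub (twisted-kernel {q} u≉0 roots≈0))
  where
  open CommutativeRing M
  open Pow M renaming (_^_ to _^ᴹ_)
  open SemiringMult semiring using (_×_)
  open IsField F using (1≉0)
  open CommutativeRingProperties M
    using (twisted-sub; [x-y]^p^k≈x^p^k-y^p^k; kernel≈0⇒injective; 1+1≈0⇒1≈0)
  open FieldProperties F using (twisted-kernel)
  open FiniteRingProperties H using (injective⇒invertible)
  open FiniteFieldProperties F using (cardinality-p^m⇒p×1≈0; z+z^q≈0⇒z≈0)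
  open NatProperties using (odd-^; [p^k]^[m/gcd]≡[p^m]^[k/gcd])

  q o t : ℕ
  q = p ^ k
  o = m / gcd k m
  t = k / gcd k m

  f : Carrier → Carrier
  f x = x * u ^ᴹ q + x ^ᴹ q * u

  p×1≈0 : p × 1# ≈ 0#
  p×1≈0 = cardinality-p^m⇒p×1≈0 p m H

  f-sub : ∀ x y → f (x - y) ≈ f x - f y
  f-sub = twisted-sub q ([x-y]^p^k≈x^p^k-y^p^k p-prime p-odd p×1≈0 k) (u ^ᴹ q) u

  roots≈0 : ∀ z → z + z ^ᴹ q ≈ 0# → z ≈ 0#
  roots≈0 = z+z^q≈0⇒z≈0 H (1≉0 ∘ 1+1≈0⇒1≈0 p p-odd p×1≈0)
                        q o t (odd-^ p k p-odd) o-odd ([p^k]^[m/gcd]≡[p^m]^[k/gcd] p k m)
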